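{- If $G$ is a graph of order $n$ with maximum degree $\Delta(G)$, then $L_{2,t}(G)\leq n+2-\Delta(G)$. Furthermore, $L_{2,t}(G)=n+2-\Delta(G)$ if and only if $G\in\Omega$.
   Context: All graphs are finite and simple; $N(v)$ is the open neighborhood of $v$, $G[S]$ the subgraph induced by $S$, and $\overline{B}=V(G)\setminus B$. A set $B\subseteq V(G)$ is a $2$-total limited packing set if $|B\cap N(v)|\leq 2$ for every $v\in V(G)$; $L_{2,t}(G)$ is the maximum cardinality of such a set. The family $\Omega$ consists of all graphs $G$ such that $V(G)=A\cup B$ for some sets $A,B$ satisfying: (i) $|A\cap B|=3$; (ii) $G[A]$ has a spanning star (a spanning subgraph isomorphic to a star), and each component of $G[B]$ is a path or a cycle; (iii) every vertex $v\in\overline{B}$ satisfies $|N(v)\cap B|\leq 2$. -}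

module Defs where

open import Data.Nat using (ℕ; zero; suc; _≤_; _⊔_)
open import Data.Fin using (Fin; toℕ)
open import Data.Bool using (Bool; true; false)
open import Data.Vec using (tabulate)
open import Data.List using (List; foldr; map; allFin)
open import Data.Fin.Subset using (Subset; _∈_; _∉_; _∩_; _∪_; ∣_∣; ⊤)
open import Data.Product using (Σ; ∃; _×_; _,_)
open import Data.Sum using (_⊎_)
open import Relation.Binary.PropositionalEquality using (_≡_; _≢_)
open import Function.Definitions using (Injective)
open import Function.Bundles using (_⇔_)

record Graph (n : ℕ) : Set where
  field
    adj    : Fin n → Fin n → Bool
    adj-sym : ∀ u v → adj u v ≡ adj v u
    adj-irr : ∀ v → adj v v ≡ false

module _ {n : ℕ} (G : Graph n) where
  open Graph G

  Adj : Fin n → Fin n → Set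
  Adj u v = adj u v ≡ true

  N : Fin n → Subset n
  N v = tabulate (adj v)

  deg : Fin n → ℕ
  deg v = ∣ N v ∣

  -- maximum degree Δ(G) (0 for the empty graph)
  maxDeg : ℕ
  maxDeg = foldr _⊔_ 0 (map deg (allFin n))

  Is2TLP : Subset n → Set
  Is2TLP B = ∀ v → ∣ B ∩ N v ∣ ≤ 2

  IsL2t : ℕ → Set
  IsL2t k = (Σ (Subset n) λ B → Is2TLP B × ∣ B ∣ ≡ k)
          × (∀ B → Is2TLP B → ∣ B ∣ ≤ k)

  HasSpanningStar : Subset n → Set
  HasSpanningStar A = Σ (Fin n) λ c → c ∈ A × (∀ v → v ∈ A → v ≢ c → Adj c v)

  data Reach (B : Subset n) (v : Fin n) : Fin n → Set where
    here : v ∈ B → Reach B v v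
    step : ∀ {u w} → Reach B v u → Adj u w → w ∈ B → Reach B v w

  PathEdge : ∀ {k} → Fin k → Fin k → Set
  PathEdge i j = toℕ j ≡ suc (toℕ i) ⊎ toℕ i ≡ suc (toℕ j)

  CycleEdge : ∀ {k} → Fin k → Fin k → Set
  CycleEdge {k} i j = PathEdge i j
                    ⊎ (toℕ i ≡ 0 × suc (toℕ j) ≡ k)
                    ⊎ (toℕ j ≡ 0 × suc (toℕ i) ≡ k)

  -- the component of G[B] containing v (v ∈ B) is listed injectively by w,
  -- and G restricted to it has exactly the edges given by E
  ComponentShaped : Subset n → Fin n → (∀ {k} → Fin k → Fin k → Set) → ℕ → Set
  ComponentShaped B v E m =
    Σ ℕ λ k → m ≤ k × Σ (Fin k → Fin n) λ w →
      Injective _≡_ _≡_ w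
      × (∀ u → Reach B v u ⇔ ∃ λ i → w i ≡ u)
      × (∀ i j → Adj (w i) (w j) ⇔ E i j)

  PathsAndCycles : Subset n → Set
  PathsAndCycles B = ∀ v → v ∈ B →
    ComponentShaped B v PathEdge 1 ⊎ ComponentShaped B v CycleEdge 3

  InΩ : Set
  InΩ = Σ (Subset n) λ A → Σ (Subset n) λ B →
          (A ∪ B ≡ ⊤)
        × ∣ A ∩ B ∣ ≡ 3
        × HasSpanningStar A
        × PathsAndCycles B
        × (∀ v → v ∉ B → ∣ N v ∩ B ∣ ≤ 2)

{-# OPTIONS --safe #-}
-- For a 2-total limited packing B and any vertex v, |B| + deg v = |B ∪ N(v)| + |B ∩ N(v)| ≤ n + 2.
-- If equality holds at a vertex v of maximum degree, then B ∪ N(v) is everything, so A = N[v]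
-- and B witness G ∈ Ω: |A ∩ B| = |A| + |B| - n = 3, and G[B] has maximum degree at most 2.
-- Conversely, if A and B witness G ∈ Ω, then |A| ≤ Δ + 1 and |A| + |B| = n + 3, and B is a
-- packing. The structural fact behind both directions is that G[B] is a disjoint union of
-- paths and cycles exactly when every vertex of B has at most two neighbours in B. For the
-- hard direction we take a path through v and extend it at one end, then at the other. If a
-- new neighbour of the front is also adjacent to the back, it closes a cycle.
module Submission where

open import Defs
open import Data.Bool using (true) renaming (_≟_ to _≟ᵇ_)
open import Data.Empty using (⊥-elim)
open import Data.Fin using (Fin; toℕ; fromℕ<)
open import Data.Fin.Properties using (toℕ-injective; toℕ<n; toℕ-fromℕ<; any?; injective⇒≤)
  renaming (_≟_ to _≟ᶠ_)
open import Data.Fin.Subset using (Subset; _∈_; _∉_; _∩_; _∪_; ∣_∣; ⊤; ⊥; ⁅_⁆; _⊆_; _-_; inside; outside)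
open import Data.Fin.Subset.Properties
open import Data.List using (map; allFin)
open import Data.List.Membership.Propositional.Properties using (foldr-selective; ∈-map⁻; ∈-allFin)
open import Data.List.Properties using (foldr-forcesᵇ)
open import Data.List.Relation.Unary.All using (All) renaming (lookup to All-lookup)
open import Data.List.Relation.Unary.All.Properties using () renaming (map⁻ to All-map⁻)
open import Data.Nat using (ℕ; zero; suc; _+_; _∸_; _≤_; _<_; z≤n; s≤s; s≤s⁻¹; _≟_)
open import Data.Nat.Properties
open import Data.Product using (∃; _×_; _,_)
open import Data.Sum using (_⊎_; inj₁; inj₂; [_,_]; swap) renaming (map to ⊎-map)
open import Data.Vec using ([]; _∷_)
open import Data.Vec.Properties using ([]=⇒lookup; lookup⇒[]=; lookup∘tabulate)
open import Function using (id; _∘_)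
open import Function.Bundles using (_⇔_; mk⇔; Equivalence)
open import Function.Construct.Composition using (_⇔-∘_)
open import Function.Construct.Symmetry using (⇔-sym)
open import Relation.Binary.PropositionalEquality
  using (_≡_; _≢_; refl; sym; trans; cong; cong₂; subst; module ≡-Reasoning)
open import Relation.Nullary using (¬_; Dec; yes; no; ¬?)
open import Relation.Nullary.Decidable using (_×-dec_; decidable-stable)

private
  variable
    n i j k m : ℕ
    E E′ : ℕ → ℕ → Set

∣p∪q∣+∣p∩q∣≡∣p∣+∣q∣ : (p q : Subset n) → ∣ p ∪ q ∣ + ∣ p ∩ q ∣ ≡ ∣ p ∣ + ∣ q ∣
∣p∪q∣+∣p∩q∣≡∣p∣+∣q∣ [] [] = refl
∣p∪q∣+∣p∩q∣≡∣p∣+∣q∣ (inside ∷ p) (inside ∷ q) =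
  cong suc (trans (+-suc _ _) (trans (cong suc (∣p∪q∣+∣p∩q∣≡∣p∣+∣q∣ p q)) (sym (+-suc _ _))))
∣p∪q∣+∣p∩q∣≡∣p∣+∣q∣ (inside ∷ p) (outside ∷ q) = cong suc (∣p∪q∣+∣p∩q∣≡∣p∣+∣q∣ p q)
∣p∪q∣+∣p∩q∣≡∣p∣+∣q∣ (outside ∷ p) (inside ∷ q) =
  trans (cong suc (∣p∪q∣+∣p∩q∣≡∣p∣+∣q∣ p q)) (sym (+-suc _ _))
∣p∪q∣+∣p∩q∣≡∣p∣+∣q∣ (outside ∷ p) (outside ∷ q) = ∣p∪q∣+∣p∩q∣≡∣p∣+∣q∣ p q

∣p∪q∣≤∣p∣+∣q∣ : (p q : Subset n) → ∣ p ∪ q ∣ ≤ ∣ p ∣ + ∣ q ∣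
∣p∪q∣≤∣p∣+∣q∣ p q = subst (∣ p ∪ q ∣ ≤_) (∣p∪q∣+∣p∩q∣≡∣p∣+∣q∣ p q) (m≤m+n _ _)

x∉p⇒∣⁅x⁆∪p∣≡1+∣p∣ : {x : Fin n} {p : Subset n} → x ∉ p → ∣ ⁅ x ⁆ ∪ p ∣ ≡ suc ∣ p ∣
x∉p⇒∣⁅x⁆∪p∣≡1+∣p∣ {n} {x} {p} x∉p = begin
  ∣ ⁅ x ⁆ ∪ p ∣                  ≡⟨ +-identityʳ _ ⟨
  ∣ ⁅ x ⁆ ∪ p ∣ + 0              ≡⟨ cong (∣ ⁅ x ⁆ ∪ p ∣ +_) ∣⁅x⁆∩p∣≡0 ⟨
  ∣ ⁅ x ⁆ ∪ p ∣ + ∣ ⁅ x ⁆ ∩ p ∣  ≡⟨ ∣p∪q∣+∣p∩q∣≡∣p∣+∣q∣ ⁅ x ⁆ p ⟩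
  ∣ ⁅ x ⁆ ∣ + ∣ p ∣              ≡⟨ cong (_+ ∣ p ∣) (∣⁅x⁆∣≡1 x) ⟩
  suc ∣ p ∣                      ∎
  where
  open ≡-Reasoning
  ⁅x⁆∩p≡⊥ : ⁅ x ⁆ ∩ p ≡ ⊥
  ⁅x⁆∩p≡⊥ = Empty-unique λ (y , y∈⁅x⁆∩p) →
    let (y∈⁅x⁆ , y∈p) = x∈p∩q⁻ ⁅ x ⁆ p y∈⁅x⁆∩p in x∉p (subst (_∈ p) (x∈⁅y⁆⇒x≡y x y∈⁅x⁆) y∈p)
  ∣⁅x⁆∩p∣≡0 : ∣ ⁅ x ⁆ ∩ p ∣ ≡ 0
  ∣⁅x⁆∩p∣≡0 = trans (cong ∣_∣ ⁅x⁆∩p≡⊥) (∣⊥∣≡0 n)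

x,y,z∈p⇒3≤∣p∣ : {x y z : Fin n} {p : Subset n} → x ∈ p → y ∈ p → z ∈ p →
                x ≢ y → x ≢ z → y ≢ z → 3 ≤ ∣ p ∣
x,y,z∈p⇒3≤∣p∣ {x = x} {y} {z} {p} x∈p y∈p z∈p x≢y x≢z y≢z = begin
  3                          ≤⟨ s≤s (s≤s (s≤s z≤n)) ⟩
  3 + ∣ p - x - y - z ∣      ≤⟨ s≤s (s≤s (x∈p⇒∣p-x∣<∣p∣ z∈p-x-y)) ⟩
  2 + ∣ p - x - y ∣          ≤⟨ s≤s (x∈p⇒∣p-x∣<∣p∣ y∈p-x) ⟩
  1 + ∣ p - x ∣              ≤⟨ x∈p⇒∣p-x∣<∣p∣ x∈p ⟩
  ∣ p ∣                      ∎
  where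
  open ≤-Reasoning
  y∈p-x : y ∈ p - x
  y∈p-x = x∈p∧x≢y⇒x∈p-y y∈p (x≢y ∘ sym)
  z∈p-x-y : z ∈ p - x - y
  z∈p-x-y = x∈p∧x≢y⇒x∈p-y (x∈p∧x≢y⇒x∈p-y z∈p (x≢z ∘ sym)) (y≢z ∘ sym)

∣p∣≤2⇒z≡x⊎z≡y : {x y z : Fin n} {p : Subset n} → ∣ p ∣ ≤ 2 →
                x ∈ p → y ∈ p → z ∈ p → x ≢ y → z ≡ x ⊎ z ≡ y
∣p∣≤2⇒z≡x⊎z≡y {x = x} {y} {z} ∣p∣≤2 x∈p y∈p z∈p x≢y with z ≟ᶠ x | z ≟ᶠ y
... | yes z≡x | _       = inj₁ z≡x
... | no _    | yes z≡y = inj₂ z≡y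
... | no z≢x  | no z≢y  =
  ⊥-elim (<⇒≱ (x,y,z∈p⇒3≤∣p∣ x∈p y∈p z∈p x≢y (z≢x ∘ sym) (z≢y ∘ sym)) ∣p∣≤2)

⊆⁅x⁆∪⁅y⁆⇒∣p∣≤2 : {x y : Fin n} {p : Subset n} → (∀ {z} → z ∈ p → z ≡ x ⊎ z ≡ y) → ∣ p ∣ ≤ 2
⊆⁅x⁆∪⁅y⁆⇒∣p∣≤2 {x = x} {y} {p} p⊆ = begin
  ∣ p ∣                  ≤⟨ p⊆q⇒∣p∣≤∣q∣ p⊆⁅x⁆∪⁅y⁆ ⟩
  ∣ ⁅ x ⁆ ∪ ⁅ y ⁆ ∣      ≤⟨ ∣p∪q∣≤∣p∣+∣q∣ ⁅ x ⁆ ⁅ y ⁆ ⟩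
  ∣ ⁅ x ⁆ ∣ + ∣ ⁅ y ⁆ ∣  ≡⟨ cong₂ _+_ (∣⁅x⁆∣≡1 x) (∣⁅x⁆∣≡1 y) ⟩
  2                      ∎
  where
  open ≤-Reasoning
  p⊆⁅x⁆∪⁅y⁆ : p ⊆ ⁅ x ⁆ ∪ ⁅ y ⁆
  p⊆⁅x⁆∪⁅y⁆ = x∈p∪q⁺ ∘ ⊎-map (λ { refl → x∈⁅x⁆ x }) (λ { refl → x∈⁅x⁆ y }) ∘ p⊆

module _ {n : ℕ} (G : Graph n) where
  open Graph G

  Adj⇒∈N : ∀ {u w} → Adj G u w → w ∈ N G u
  Adj⇒∈N {u} {w} uw = lookup⇒[]= w _ (trans (lookup∘tabulate (adj u) w) uw)

  ∈N⇒Adj : ∀ {u w} → w ∈ N G u → Adj G u w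
  ∈N⇒Adj {u} {w} w∈Nu = trans (sym (lookup∘tabulate (adj u) w)) ([]=⇒lookup w∈Nu)

  Adj-sym : ∀ {u w} → Adj G u w → Adj G w u
  Adj-sym {u} {w} uw = trans (adj-sym w u) uw

  Adj-sym⇔ : ∀ {u w} → Adj G u w ⇔ Adj G w u
  Adj-sym⇔ = mk⇔ Adj-sym Adj-sym

  Adj-irrefl : ∀ {u} → ¬ Adj G u u
  Adj-irrefl {u} uu with () ← trans (sym uu) (adj-irr u)

  Adj? : ∀ u w → Dec (Adj G u w)
  Adj? u w = adj u w ≟ᵇ true

  MaxDegree≤2 : Subset n → Set
  MaxDegree≤2 B = ∀ u → u ∈ B → ∣ B ∩ N G u ∣ ≤ 2

  u∉N[u] : ∀ u → u ∉ N G u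
  u∉N[u] u = Adj-irrefl ∘ ∈N⇒Adj

  deg≤maxDeg : ∀ u → deg G u ≤ maxDeg G
  deg≤maxDeg u = All-lookup (All-map⁻ degrees≤maxDeg) (∈-allFin u)
    where
    degrees≤maxDeg : All (_≤ maxDeg G) (map (deg G) (allFin n))
    degrees≤maxDeg = foldr-forcesᵇ (λ a b a⊔b≤ → m⊔n≤o⇒m≤o a b a⊔b≤ , m⊔n≤o⇒n≤o a b a⊔b≤) 0 _ ≤-refl

  maxDeg≡0⊎attained : maxDeg G ≡ 0 ⊎ ∃ λ v → deg G v ≡ maxDeg G
  maxDeg≡0⊎attained with foldr-selective ⊔-sel 0 (map (deg G) (allFin n))
  ... | inj₁ ≡0 = inj₁ ≡0
  ... | inj₂ ∈degrees = let (v , _ , Δ≡deg) = ∈-map⁻ (deg G) ∈degrees in inj₂ (v , sym Δ≡deg)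

  ∣N[u]∣≡1+deg : ∀ u → ∣ ⁅ u ⁆ ∪ N G u ∣ ≡ suc (deg G u)
  ∣N[u]∣≡1+deg u = x∉p⇒∣⁅x⁆∪p∣≡1+∣p∣ (u∉N[u] u)

  spanningStar⇒∣A∣≤1+maxDeg : ∀ {A} → HasSpanningStar G A → ∣ A ∣ ≤ suc (maxDeg G)
  spanningStar⇒∣A∣≤1+maxDeg {A} (c , _ , star) = begin
    ∣ A ∣                ≤⟨ p⊆q⇒∣p∣≤∣q∣ A⊆N[c] ⟩
    ∣ ⁅ c ⁆ ∪ N G c ∣    ≡⟨ ∣N[u]∣≡1+deg c ⟩
    suc (deg G c)        ≤⟨ s≤s (deg≤maxDeg c) ⟩
    suc (maxDeg G)       ∎
    where
    open ≤-Reasoning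
    A⊆N[c] : A ⊆ ⁅ c ⁆ ∪ N G c
    A⊆N[c] {u} u∈A with u ≟ᶠ c
    ... | yes refl = x∈p∪q⁺ (inj₁ (x∈⁅x⁆ u))
    ... | no u≢c   = x∈p∪q⁺ (inj₂ (Adj⇒∈N (star u u∈A u≢c)))

-- Index-level forms of PathEdge and CycleEdge: at toℕ i and toℕ j they unfold to exactly those.
Consecutive : ℕ → ℕ → Set
Consecutive i j = j ≡ suc i ⊎ i ≡ suc j

CyclicallyConsecutive : ℕ → ℕ → ℕ → Set
CyclicallyConsecutive k i j = Consecutive i j ⊎ (i ≡ 0 × suc j ≡ k) ⊎ (j ≡ 0 × suc i ≡ k)

Consecutive-sym : Consecutive i j → Consecutive j i
Consecutive-sym = swap

Consecutive-irrefl : ¬ Consecutive i i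
Consecutive-irrefl (inj₁ i≡1+i) = 1+n≢n (sym i≡1+i)
Consecutive-irrefl (inj₂ i≡1+i) = 1+n≢n (sym i≡1+i)

Consecutive-suc⇔ : Consecutive (suc i) (suc j) ⇔ Consecutive i j
Consecutive-suc⇔ = mk⇔ (⊎-map suc-injective suc-injective) (⊎-map (cong suc) (cong suc))

m∸j≡1+m∸i⇔i≡1+j : i ≤ m → j ≤ m → m ∸ j ≡ suc (m ∸ i) ⇔ i ≡ suc j
m∸j≡1+m∸i⇔i≡1+j {i} {m} {j} i≤m j≤m = mk⇔
  (λ e → +-cancelˡ-≡ (m ∸ i) i (suc j) (begin
    (m ∸ i) + i       ≡⟨ balance ⟨
    (m ∸ j) + j       ≡⟨ cong (_+ j) e ⟩
    suc (m ∸ i) + j   ≡⟨ +-suc (m ∸ i) j ⟨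
    (m ∸ i) + suc j   ∎))
  (λ e → +-cancelʳ-≡ j (m ∸ j) (suc (m ∸ i)) (begin
    (m ∸ j) + j       ≡⟨ balance ⟩
    (m ∸ i) + i       ≡⟨ cong ((m ∸ i) +_) e ⟩
    (m ∸ i) + suc j   ≡⟨ +-suc (m ∸ i) j ⟩
    suc (m ∸ i) + j   ∎))
  where
  open ≡-Reasoning
  balance : (m ∸ j) + j ≡ (m ∸ i) + i
  balance = trans (m∸n+n≡m j≤m) (sym (m∸n+n≡m i≤m))

Consecutive-reverse⇔ : i ≤ m → j ≤ m → Consecutive (m ∸ i) (m ∸ j) ⇔ Consecutive i j
Consecutive-reverse⇔ i≤m j≤m = mk⇔
  (swap ∘ ⊎-map (to (m∸j≡1+m∸i⇔i≡1+j i≤m j≤m)) (to (m∸j≡1+m∸i⇔i≡1+j j≤m i≤m)))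
  (⊎-map (from (m∸j≡1+m∸i⇔i≡1+j i≤m j≤m)) (from (m∸j≡1+m∸i⇔i≡1+j j≤m i≤m)) ∘ swap)
  where open Equivalence

cyclicPred : ℕ → ℕ → ℕ
cyclicPred k zero    = k ∸ 1
cyclicPred k (suc i) = i

cyclicSuc : ℕ → ℕ → ℕ
cyclicSuc k i with suc i ≟ k
... | yes _ = 0
... | no _  = suc i

cyclicPred< : i < k → cyclicPred k i < k
cyclicPred< {zero}  {suc k} _   = ≤-refl
cyclicPred< {suc i} {k}     i<k = <-trans (n<1+n i) i<k

cyclicSuc< : i < k → cyclicSuc k i < k
cyclicSuc< {i} {k} i<k with suc i ≟ k
... | yes _     = ≤-trans (s≤s z≤n) i<k
... | no 1+i≢k  = ≤∧≢⇒< i<k 1+i≢k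

cyclicPred-consecutive : i < k → CyclicallyConsecutive k i (cyclicPred k i)
cyclicPred-consecutive {zero}  {suc k} _ = inj₂ (inj₁ (refl , refl))
cyclicPred-consecutive {suc i} _         = inj₁ (inj₂ refl)

cyclicSuc-consecutive : CyclicallyConsecutive k i (cyclicSuc k i)
cyclicSuc-consecutive {k} {i} with suc i ≟ k
... | yes 1+i≡k = inj₂ (inj₂ (refl , 1+i≡k))
... | no _      = inj₁ (inj₁ refl)

cyclicPred≢cyclicSuc : 3 ≤ k → cyclicPred k i ≢ cyclicSuc k i
cyclicPred≢cyclicSuc {i = i} (s≤s (s≤s (s≤s {n = k} _))) with suc i ≟ 3 + k
cyclicPred≢cyclicSuc {i = zero}        _ | yes ()
cyclicPred≢cyclicSuc {i = suc zero}    _ | yes ()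
cyclicPred≢cyclicSuc {i = suc (suc i)} _ | yes refl = λ ()
cyclicPred≢cyclicSuc {i = zero}        _ | no _     = λ ()
cyclicPred≢cyclicSuc {i = suc i}       _ | no _     = λ ()

cyclicallyConsecutive⇒pred⊎suc : j < k → CyclicallyConsecutive k i j →
                                 j ≡ cyclicPred k i ⊎ j ≡ cyclicSuc k i
cyclicallyConsecutive⇒pred⊎suc _ (inj₁ (inj₂ refl))          = inj₁ refl
cyclicallyConsecutive⇒pred⊎suc _ (inj₂ (inj₁ (refl , refl))) = inj₁ refl
cyclicallyConsecutive⇒pred⊎suc {j} {k} {i} j<k (inj₁ (inj₁ refl)) with suc i ≟ k
... | yes refl = ⊥-elim (<-irrefl refl j<k)
... | no _     = inj₂ refl
cyclicallyConsecutive⇒pred⊎suc {_} {k} {i} _ (inj₂ (inj₂ (refl , 1+i≡k))) with suc i ≟ k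
... | yes _    = inj₂ refl
... | no 1+i≢k = ⊥-elim (1+i≢k 1+i≡k)

module Listings {n : ℕ} (G : Graph n) (B : Subset n) (v : Fin n) where

  record Listing (k : ℕ) (E : ℕ → ℕ → Set) : Set where
    field
      vertex    : ℕ → Fin n
      inB       : ∀ {i} → i < k → vertex i ∈ B
      injective : ∀ {i j} → i < k → j < k → vertex i ≡ vertex j → i ≡ j
      reachable : ∀ {i} → i < k → Reach G B v (vertex i)
      lists-v   : ∃ λ i → i < k × vertex i ≡ v
      adjacency : ∀ {i j} → i < k → j < k → Adj G (vertex i) (vertex j) ⇔ E i j

  open Listing public

  Listed : Listing k E → Fin n → Set
  Listed {k} L x = ∃ λ i → i < k × vertex L i ≡ x

  listed? : (L : Listing k E) → ∀ x → Dec (Listed L x)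
  listed? {k} L x = anyUpTo? (λ i → vertex L i ≟ᶠ x) k

  ClosedAt : Listing k E → ℕ → Set
  ClosedAt L i = ∀ {y} → y ∈ B → Adj G (vertex L i) y → Listed L y

  Closed : Listing k E → Set
  Closed {k} L = ∀ {i} → i < k → ClosedAt L i

  Exit : Listing k E → ℕ → Set
  Exit L i = ∃ λ x → x ∈ B × Adj G (vertex L i) x × ¬ Listed L x

  closedAt⊎exit : (L : Listing k E) (i : ℕ) → ClosedAt L i ⊎ Exit L i
  closedAt⊎exit L i with any? (λ x → x ∈? B ×-dec Adj? G (vertex L i) x ×-dec ¬? (listed? L x))
  ... | yes exit = inj₂ exit
  ... | no ¬exit = inj₁ λ {y} y∈B adj →
    decidable-stable (listed? L y) (λ y∉L → ¬exit (y , y∈B , adj , y∉L))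

  length≤n : Listing k E → k ≤ n
  length≤n L =
    injective⇒≤ {f = vertex L ∘ toℕ} (λ e → toℕ-injective (injective L (toℕ<n _) (toℕ<n _) e))

  reach⇒listed : (L : Listing k E) → Closed L → ∀ {u} → Reach G B v u → Listed L u
  reach⇒listed L closed (here _) = lists-v L
  reach⇒listed L closed (step reach adj y∈B) with reach⇒listed L closed reach
  ... | i , i<k , refl = closed i<k y∈B adj

  toComponentShaped : (E : ℕ → ℕ → ℕ → Set) (L : Listing k (E k)) → Closed L → m ≤ k →
                      ComponentShaped G B v (λ {k′} i j → E k′ (toℕ i) (toℕ j)) m
  toComponentShaped {k} E L closed m≤k =
    k , m≤k , vertex L ∘ toℕ , (λ e → toℕ-injective (injective L (toℕ<n _) (toℕ<n _) e)) ,
    (λ u → mk⇔ (toFin ∘ reach⇒listed L closed) (λ { (i , refl) → reachable L (toℕ<n i) })) ,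
    (λ i j → adjacency L (toℕ<n i) (toℕ<n j))
    where
    toFin : ∀ {u} → Listed L u → ∃ λ (i : Fin k) → vertex L (toℕ i) ≡ u
    toFin (i , i<k , e) = fromℕ< i<k , trans (cong (vertex L) (toℕ-fromℕ< i<k)) e

  prepend : Fin n → (ℕ → Fin n) → ℕ → Fin n
  prepend x f zero    = x
  prepend x f (suc i) = f i

  module Prepend {k : ℕ} {E : ℕ → ℕ → Set} (L : Listing (suc k) E) {x : Fin n}
                 (x∈B : x ∈ B) (x∉L : ¬ Listed L x) (Lx : Adj G (vertex L 0) x) where

    listed-suc : ∀ {y} → Listed L y → ∃ λ i → i < suc (suc k) × prepend x (vertex L) i ≡ y
    listed-suc (i , i<k , e) = suc i , s≤s i<k , e

    listing : (∀ {i j} → E′ i j → E′ j i) → ¬ E′ 0 0 → (∀ {i j} → E′ (suc i) (suc j) ⇔ E i j) →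
              (∀ {j} → j < suc k → Adj G x (vertex L j) ⇔ E′ 0 (suc j)) →
              Listing (suc (suc k)) E′
    listing {E′} E′-sym ¬E′00 E′-suc x-adjacency = record
      { vertex    = prepend x (vertex L)
      ; inB       = λ { {zero} _ → x∈B ; {suc i} i< → inB L (s≤s⁻¹ i<) }
      ; injective = injective′
      ; reachable = λ { {zero} _ → step (reachable L (s≤s z≤n)) Lx x∈B
                      ; {suc i} i< → reachable L (s≤s⁻¹ i<) }
      ; lists-v   = listed-suc (lists-v L)
      ; adjacency = adjacency′
      }
      where
      injective′ : ∀ {i j} → i < suc (suc k) → j < suc (suc k) →
                   prepend x (vertex L) i ≡ prepend x (vertex L) j → i ≡ j
      injective′ {zero}  {zero}  _  _  _ = refl
      injective′ {zero}  {suc j} _  j< e = ⊥-elim (x∉L (j , s≤s⁻¹ j< , sym e))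
      injective′ {suc i} {zero}  i< _  e = ⊥-elim (x∉L (i , s≤s⁻¹ i< , e))
      injective′ {suc i} {suc j} i< j< e = cong suc (injective L (s≤s⁻¹ i<) (s≤s⁻¹ j<) e)

      adjacency′ : ∀ {i j} → i < suc (suc k) → j < suc (suc k) →
                   Adj G (prepend x (vertex L) i) (prepend x (vertex L) j) ⇔ E′ i j
      adjacency′ {zero}  {zero}  _  _  = mk⇔ (⊥-elim ∘ Adj-irrefl G) (⊥-elim ∘ ¬E′00)
      adjacency′ {zero}  {suc j} _  j< = x-adjacency (s≤s⁻¹ j<)
      adjacency′ {suc i} {zero}  i< _  = mk⇔ E′-sym E′-sym ⇔-∘ (x-adjacency (s≤s⁻¹ i<) ⇔-∘ Adj-sym⇔ G)
      adjacency′ {suc i} {suc j} i< j< = ⇔-sym E′-suc ⇔-∘ adjacency L (s≤s⁻¹ i<) (s≤s⁻¹ j<)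

  Path : ℕ → Set
  Path m = Listing (suc m) Consecutive

  FrontClosed : Path m → Set
  FrontClosed p = ClosedAt p 0

  BackClosed : Path m → Set
  BackClosed {m} p = ClosedAt p m

  singleton : v ∈ B → Path 0
  singleton v∈B = record
    { vertex    = λ _ → v
    ; inB       = λ _ → v∈B
    ; injective = λ { (s≤s z≤n) (s≤s z≤n) _ → refl }
    ; reachable = λ _ → here v∈B
    ; lists-v   = 0 , s≤s z≤n , refl
    ; adjacency = λ { (s≤s z≤n) (s≤s z≤n) →
                      mk⇔ (⊥-elim ∘ Adj-irrefl G) (⊥-elim ∘ Consecutive-irrefl) }
    }

  reverse : Path m → Path m
  reverse {m} p = record
    { vertex    = λ i → vertex p (m ∸ i)
    ; inB       = λ {i} _ → inB p (m∸i<1+m i)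
    ; injective = λ {i} {j} i< j< e →
                    ∸-cancelˡ-≡ (s≤s⁻¹ i<) (s≤s⁻¹ j<) (injective p (m∸i<1+m i) (m∸i<1+m j) e)
    ; reachable = λ {i} _ → reachable p (m∸i<1+m i)
    ; lists-v   = listed-reverse (lists-v p)
    ; adjacency = λ {i} {j} i< j< →
        Consecutive-reverse⇔ (s≤s⁻¹ i<) (s≤s⁻¹ j<) ⇔-∘ adjacency p (m∸i<1+m i) (m∸i<1+m j)
    }
    where
    m∸i<1+m : ∀ i → m ∸ i < suc m
    m∸i<1+m i = s≤s (m∸n≤m m i)
    listed-reverse : ∀ {y} → Listed p y → ∃ λ i → i < suc m × vertex p (m ∸ i) ≡ y
    listed-reverse (i , i< , e) = m ∸ i , m∸i<1+m i , trans (cong (vertex p) (m∸[m∸n]≡n (s≤s⁻¹ i<))) e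

  reverse-backClosed : (p : Path m) → FrontClosed p → BackClosed (reverse p)
  reverse-backClosed {m} p front {y} y∈B adj
    with i , i< , e ← front y∈B (subst (λ i → Adj G (vertex p i) y) (n∸n≡0 m) adj) =
    m ∸ i , s≤s (m∸n≤m m i) , trans (cong (vertex p) (m∸[m∸n]≡n (s≤s⁻¹ i<))) e

  module Extend {m : ℕ} (p : Path m) {x : Fin n}
                (x∈B : x ∈ B) (x∉p : ¬ Listed p x) (px : Adj G (vertex p 0) x) where
    open Prepend p x∈B x∉p px

    extend : (∀ {j} → j < suc m → Adj G x (vertex p j) → j ≡ 0) → Path (suc m)
    extend front-only = listing Consecutive-sym Consecutive-irrefl Consecutive-suc⇔ λ j< →
      mk⇔ (λ xp → inj₁ (cong suc (front-only j< xp))) λ { (inj₁ refl) → Adj-sym G px ; (inj₂ ()) }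

    extend-backClosed : (front-only : ∀ {j} → j < suc m → Adj G x (vertex p j) → j ≡ 0) →
                        BackClosed p → BackClosed (extend front-only)
    extend-backClosed _ back y∈B adj = listed-suc (back y∈B adj)

    closeCycle : Adj G x (vertex p m) → (∀ {j} → j < suc m → Adj G x (vertex p j) → j ≡ 0 ⊎ j ≡ m) →
                 Listing (2 + m) (CyclicallyConsecutive (2 + m))
    closeCycle x-back ends-only = listing (⊎-map swap swap) ¬cc00 cc-suc x-adjacency
      where
      ¬cc00 : ¬ CyclicallyConsecutive (2 + m) 0 0
      ¬cc00 (inj₁ c)             = Consecutive-irrefl c
      ¬cc00 (inj₂ (inj₁ (_ , ()))) 
      ¬cc00 (inj₂ (inj₂ (_ , ())))
      cc-suc : ∀ {i j} → CyclicallyConsecutive (2 + m) (suc i) (suc j) ⇔ Consecutive i j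
      cc-suc = mk⇔ (λ { (inj₁ c) → Equivalence.to Consecutive-suc⇔ c
                      ; (inj₂ (inj₁ (() , _))) ; (inj₂ (inj₂ (() , _))) })
                   (inj₁ ∘ Equivalence.from Consecutive-suc⇔)
      x-adjacency : ∀ {j} → j < suc m → Adj G x (vertex p j) ⇔ CyclicallyConsecutive (2 + m) 0 (suc j)
      x-adjacency j< = mk⇔
        (λ xp → [ (λ { refl → inj₁ (inj₁ refl) }) , (λ { refl → inj₂ (inj₁ (refl , refl)) }) ]
                  (ends-only j< xp))
        λ { (inj₁ (inj₁ refl)) → Adj-sym G px ; (inj₂ (inj₁ (_ , refl))) → x-back
          ; (inj₁ (inj₂ ())) ; (inj₂ (inj₂ (() , _))) }

module MaxDegreeTwo {n : ℕ} (G : Graph n) {B : Subset n} (≤2 : MaxDegree≤2 G B) (v : Fin n) where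
  open Listings G B v

  closedAt-twoNeighbours : (L : Listing k E) → i < k → ∀ {j₁ j₂} → j₁ < k → j₂ < k → j₁ ≢ j₂ →
                           E i j₁ → E i j₂ → ClosedAt L i
  closedAt-twoNeighbours {k = k} {E = E} {i = i} L i< j₁< j₂< j₁≢j₂ ij₁ ij₂ {y} y∈B adj =
    [ (λ y≡ → _ , j₁< , sym y≡) , (λ y≡ → _ , j₂< , sym y≡) ]
      (∣p∣≤2⇒z≡x⊎z≡y (≤2 _ (inB L i<)) (neighbour j₁< ij₁) (neighbour j₂< ij₂)
                     (x∈p∩q⁺ (y∈B , Adj⇒∈N G adj)) (j₁≢j₂ ∘ injective L j₁< j₂<))
    where
    neighbour : ∀ {j} → j < k → E i j → vertex L j ∈ B ∩ N G (vertex L i)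
    neighbour j< ij = x∈p∩q⁺ (inB L j< , Adj⇒∈N G (Equivalence.from (adjacency L i< j<) ij))

  cycle-closed : (c : Listing k (CyclicallyConsecutive k)) → 3 ≤ k → Closed c
  cycle-closed c 3≤k i< = closedAt-twoNeighbours c i< (cyclicPred< i<) (cyclicSuc< i<)
    (cyclicPred≢cyclicSuc 3≤k) (cyclicPred-consecutive i<) cyclicSuc-consecutive

  path-internal-closed : (p : Path m) → 2 + i ≤ m → ClosedAt p (suc i)
  path-internal-closed {m} {i} p 2+i≤m =
    closedAt-twoNeighbours p (s≤s 1+i≤m) (s≤s (≤-trans (n≤1+n i) 1+i≤m)) (s≤s 2+i≤m)
      (λ ()) (inj₂ refl) (inj₁ refl)
    where
    1+i≤m : suc i ≤ m
    1+i≤m = ≤-trans (n≤1+n (suc i)) 2+i≤m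

  exit⇒end : (p : Path m) {x : Fin n} → x ∈ B → ¬ Listed p x →
             ∀ {j} → j < suc m → Adj G x (vertex p j) → j ≡ 0 ⊎ j ≡ m
  exit⇒end p {x} x∈B x∉p {zero} _ _ = inj₁ refl
  exit⇒end p {x} x∈B x∉p {suc j} j< xp with m≤n⇒m<n∨m≡n (s≤s⁻¹ j<)
  ... | inj₂ j≡m = inj₂ j≡m
  ... | inj₁ j<m = ⊥-elim (x∉p (path-internal-closed p j<m x∈B (Adj-sym G xp)))

  path-closed : (p : Path m) → FrontClosed p → BackClosed p → Closed p
  path-closed p front back {zero} _ = front
  path-closed p front back {suc i} i< with m≤n⇒m<n∨m≡n (s≤s⁻¹ i<)
  ... | inj₁ 2+i≤m = path-internal-closed p 2+i≤m
  ... | inj₂ refl  = back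

  data FrontClosing (p : Path m) : Set where
    cycle : ComponentShaped G B v (CycleEdge G) 3 → FrontClosing p
    path  : (q : Path k) → FrontClosed q → (BackClosed p → BackClosed q) → FrontClosing p

  inherit : {p : Path m} {p′ : Path k} →
            (BackClosed p → BackClosed p′) → FrontClosing p′ → FrontClosing p
  inherit _     (cycle c)          = cycle c
  inherit p→p′ (path q front back) = path q front (back ∘ p→p′)

  -- A path has at most n vertices (length≤n), so n front extensions always suffice.
  mutual
    closeFront : ∀ fuel (p : Path m) → n ≤ m + fuel → FrontClosing p
    closeFront {m} zero p n≤m+0 = ⊥-elim (<⇒≱ (length≤n p) (subst (n ≤_) (+-identityʳ m) n≤m+0))
    closeFront {m} (suc fuel) p n≤m+1+fuel with closedAt⊎exit p 0
    ... | inj₁ front = path p front id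
    ... | inj₂ exit  = growFront fuel p (subst (n ≤_) (+-suc m fuel) n≤m+1+fuel) exit

    growFront : ∀ fuel (p : Path m) → n ≤ suc m + fuel → Exit p 0 → FrontClosing p
    growFront {zero} fuel p n≤ (x , x∈B , px , x∉p) =
      inherit (extend-backClosed front-only) (closeFront fuel (extend front-only) n≤)
      where
      open Extend p x∈B x∉p px
      front-only : ∀ {j} → j < 1 → Adj G x (vertex p j) → j ≡ 0
      front-only (s≤s z≤n) _ = refl
    growFront {suc m} fuel p n≤ (x , x∈B , px , x∉p) with Adj? G x (vertex p (suc m))
    ... | yes x-back = cycle (toComponentShaped CyclicallyConsecutive c (cycle-closed c 3≤3+m) 3≤3+m)
      where
      open Extend p x∈B x∉p px
      3≤3+m : 3 ≤ 3 + m
      3≤3+m = s≤s (s≤s (s≤s z≤n))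
      c : Listing (3 + m) (CyclicallyConsecutive (3 + m))
      c = closeCycle x-back (exit⇒end p x∈B x∉p)
    ... | no ¬x-back =
      inherit (extend-backClosed front-only) (closeFront fuel (extend front-only) n≤)
      where
      open Extend p x∈B x∉p px
      front-only : ∀ {j} → j < 2 + m → Adj G x (vertex p j) → j ≡ 0
      front-only j< xp = [ id , (λ { refl → ⊥-elim (¬x-back xp) }) ] (exit⇒end p x∈B x∉p j< xp)

  component : v ∈ B → ComponentShaped G B v (PathEdge G) 1 ⊎ ComponentShaped G B v (CycleEdge G) 3
  component v∈B with closeFront n (singleton v∈B) ≤-refl
  ... | cycle c = inj₂ c
  ... | path p front _ with closeFront n (reverse p) (m≤n+m n _)
  ...   | cycle c = inj₂ c
  ...   | path q front′ back = inj₁ (toComponentShaped (λ _ → Consecutive) q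
          (path-closed q front′ (back (reverse-backClosed p front))) (s≤s z≤n))

module _ {n : ℕ} (G : Graph n) where

  maxDegree≤2⇒pathsAndCycles : ∀ {B} → MaxDegree≤2 G B → PathsAndCycles G B
  maxDegree≤2⇒pathsAndCycles ≤2 v = MaxDegreeTwo.component G ≤2 v

  componentShaped⇒degree≤2 : ∀ {B u} {E : ∀ {k} → Fin k → Fin k → Set} →
    (∀ {k} {i j : Fin k} → E i j → CyclicallyConsecutive k (toℕ i) (toℕ j)) →
    u ∈ B → ComponentShaped G B u E m → ∣ B ∩ N G u ∣ ≤ 2
  componentShaped⇒degree≤2 {B = B} E⊆ u∈B (k , _ , w , _ , reach⇔ , adj⇔)
    with i , refl ← Equivalence.to (reach⇔ _) (here u∈B) = ⊆⁅x⁆∪⁅y⁆⇒∣p∣≤2 neighbour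
    where
    pred< : cyclicPred k (toℕ i) < k
    pred< = cyclicPred< (toℕ<n i)
    suc< : cyclicSuc k (toℕ i) < k
    suc< = cyclicSuc< (toℕ<n i)
    at : ∀ {j c} (c<k : c < k) → toℕ j ≡ c → w j ≡ w (fromℕ< c<k)
    at c<k e = cong w (toℕ-injective (trans e (sym (toℕ-fromℕ< c<k))))
    neighbour : ∀ {y} → y ∈ B ∩ N G (w i) → y ≡ w (fromℕ< pred<) ⊎ y ≡ w (fromℕ< suc<)
    neighbour y∈ with y∈B , y∈N ← x∈p∩q⁻ B _ y∈
                 with j , refl ← Equivalence.to (reach⇔ _) (step (here u∈B) (∈N⇒Adj G y∈N) y∈B) =
      ⊎-map (at pred<) (at suc<)
        (cyclicallyConsecutive⇒pred⊎suc (toℕ<n j) (E⊆ (Equivalence.to (adj⇔ i j) (∈N⇒Adj G y∈N))))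

  pathsAndCycles⇒maxDegree≤2 : ∀ {B} → PathsAndCycles G B → MaxDegree≤2 G B
  pathsAndCycles⇒maxDegree≤2 pc u u∈B =
    [ componentShaped⇒degree≤2 inj₁ u∈B , componentShaped⇒degree≤2 id u∈B ] (pc u u∈B)

  packing+deg≤n+2 : ∀ B → Is2TLP G B → ∀ v → ∣ B ∣ + deg G v ≤ n + 2
  packing+deg≤n+2 B packing v = begin
    ∣ B ∣ + deg G v                        ≡⟨ ∣p∪q∣+∣p∩q∣≡∣p∣+∣q∣ B (N G v) ⟨
    ∣ B ∪ N G v ∣ + ∣ B ∩ N G v ∣          ≤⟨ +-mono-≤ (∣p∣≤n (B ∪ N G v)) (packing v) ⟩
    n + 2                                  ∎
    where open ≤-Reasoning

  packing-bound : ∀ B → Is2TLP G B → ∣ B ∣ + maxDeg G ≤ n + 2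
  packing-bound B packing with maxDeg≡0⊎attained G
  ... | inj₁ Δ≡0 rewrite Δ≡0 | +-identityʳ ∣ B ∣ = ≤-trans (∣p∣≤n B) (m≤m+n n 2)
  ... | inj₂ (v , deg≡Δ) rewrite sym deg≡Δ = packing+deg≤n+2 B packing v

  Ω⇒large-packing : InΩ G → ∃ λ B → Is2TLP G B × n + 2 ≤ ∣ B ∣ + maxDeg G
  Ω⇒large-packing (A , B , A∪B≡⊤ , ∣A∩B∣≡3 , star , pc , outside≤2) = B , packing , s≤s⁻¹ (begin
    suc (n + 2)               ≡⟨ +-suc n 2 ⟨
    n + 3                     ≡⟨ cong₂ _+_ (trans (cong ∣_∣ A∪B≡⊤) (∣⊤∣≡n n)) ∣A∩B∣≡3 ⟨
    ∣ A ∪ B ∣ + ∣ A ∩ B ∣     ≡⟨ ∣p∪q∣+∣p∩q∣≡∣p∣+∣q∣ A B ⟩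
    ∣ A ∣ + ∣ B ∣             ≤⟨ +-monoˡ-≤ ∣ B ∣ (spanningStar⇒∣A∣≤1+maxDeg G star) ⟩
    suc (maxDeg G + ∣ B ∣)    ≡⟨ cong suc (+-comm (maxDeg G) ∣ B ∣) ⟩
    suc (∣ B ∣ + maxDeg G)    ∎)
    where
    open ≤-Reasoning
    packing : Is2TLP G B
    packing u with u ∈? B
    ... | yes u∈B = pathsAndCycles⇒maxDegree≤2 pc u u∈B
    ... | no u∉B  = subst (_≤ 2) (cong ∣_∣ (∩-comm (N G u) B)) (outside≤2 u u∉B)

  extremal-packing⇒Ω : ∀ B → Is2TLP G B → ∣ B ∣ + maxDeg G ≡ n + 2 → InΩ G
  extremal-packing⇒Ω B packing extremal with maxDeg≡0⊎attained G
  ... | inj₁ Δ≡0 = ⊥-elim (m+1+n≰m n (begin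
    n + 2              ≡⟨ extremal ⟨
    ∣ B ∣ + maxDeg G   ≡⟨ cong (∣ B ∣ +_) Δ≡0 ⟩
    ∣ B ∣ + 0          ≡⟨ +-identityʳ ∣ B ∣ ⟩
    ∣ B ∣              ≤⟨ ∣p∣≤n B ⟩
    n                  ∎))
    where open ≤-Reasoning
  ... | inj₂ (v , deg≡Δ) =
    A , B , A∪B≡⊤ , ∣A∩B∣≡3 , (v , x∈p∪q⁺ (inj₁ (x∈⁅x⁆ v)) , star) ,
    maxDegree≤2⇒pathsAndCycles {B} (λ u _ → packing u) ,
    (λ u _ → subst (_≤ 2) (cong ∣_∣ (∩-comm B (N G u))) (packing u))
    where
    A : Subset n
    A = ⁅ v ⁆ ∪ N G v

    ∣B∣+deg≡n+2 : ∣ B ∣ + deg G v ≡ n + 2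
    ∣B∣+deg≡n+2 = trans (cong (∣ B ∣ +_) deg≡Δ) extremal

    ∣B∪N∣≡n : ∣ B ∪ N G v ∣ ≡ n
    ∣B∪N∣≡n = ≤-antisym (∣p∣≤n (B ∪ N G v)) (+-cancelʳ-≤ 2 n _ (begin
      n + 2                            ≡⟨ ∣B∣+deg≡n+2 ⟨
      ∣ B ∣ + deg G v                  ≡⟨ ∣p∪q∣+∣p∩q∣≡∣p∣+∣q∣ B (N G v) ⟨
      ∣ B ∪ N G v ∣ + ∣ B ∩ N G v ∣    ≤⟨ +-monoʳ-≤ ∣ B ∪ N G v ∣ (packing v) ⟩
      ∣ B ∪ N G v ∣ + 2                ∎))
      where open ≤-Reasoning

    covered : ∀ x → x ∈ B ⊎ x ∈ N G v
    covered x = x∈p∪q⁻ B (N G v) (subst (x ∈_) (sym (∣p∣≡n⇒p≡⊤ ∣B∪N∣≡n)) ∈⊤)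

    A∪B≡⊤ : A ∪ B ≡ ⊤
    A∪B≡⊤ = ⊆-antisym ⊆⊤ λ {x} _ → B∪N⊆A∪B (covered x)
      where
      B∪N⊆A∪B : ∀ {x} → x ∈ B ⊎ x ∈ N G v → x ∈ A ∪ B
      B∪N⊆A∪B = x∈p∪q⁺ ∘ [ inj₂ , inj₁ ∘ x∈p∪q⁺ ∘ inj₂ ]

    ∣A∩B∣≡3 : ∣ A ∩ B ∣ ≡ 3
    ∣A∩B∣≡3 = +-cancelˡ-≡ n _ 3 (begin
      n + ∣ A ∩ B ∣               ≡⟨ cong (_+ ∣ A ∩ B ∣) (trans (cong ∣_∣ A∪B≡⊤) (∣⊤∣≡n n)) ⟨
      ∣ A ∪ B ∣ + ∣ A ∩ B ∣       ≡⟨ ∣p∪q∣+∣p∩q∣≡∣p∣+∣q∣ A B ⟩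
      ∣ A ∣ + ∣ B ∣               ≡⟨ cong (_+ ∣ B ∣) (∣N[u]∣≡1+deg G v) ⟩
      suc (deg G v + ∣ B ∣)       ≡⟨ cong suc (trans (+-comm (deg G v) ∣ B ∣) ∣B∣+deg≡n+2) ⟩
      suc (n + 2)                 ≡⟨ +-suc n 2 ⟨
      n + 3                       ∎)
      where open ≡-Reasoning

    star : ∀ u → u ∈ A → u ≢ v → Adj G v u
    star u u∈A u≢v =
      [ (λ u∈⁅v⁆ → ⊥-elim (u≢v (x∈⁅y⁆⇒x≡y v u∈⁅v⁆))) , ∈N⇒Adj G ] (x∈p∪q⁻ ⁅ v ⁆ (N G v) u∈A)

mainTheorem3 : (n : ℕ) (G : Graph n) (k : ℕ) → IsL2t G k →
    (k ≤ n + 2 ∸ maxDeg G) × (k ≡ n + 2 ∸ maxDeg G ⇔ InΩ G)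
mainTheorem3 n G _ ((B , packing , refl) , maximum) =
  m+n≤o⇒m≤o∸n ∣ B ∣ bound , mk⇔ extremal⇒Ω Ω⇒extremal
  where
  bound : ∣ B ∣ + maxDeg G ≤ n + 2
  bound = packing-bound G B packing

  extremal⇒Ω : ∣ B ∣ ≡ n + 2 ∸ maxDeg G → InΩ G
  extremal⇒Ω e = extremal-packing⇒Ω G B packing
    (trans (cong (_+ maxDeg G) e) (m∸n+n≡m (m+n≤o⇒n≤o ∣ B ∣ bound)))

  Ω⇒extremal : InΩ G → ∣ B ∣ ≡ n + 2 ∸ maxDeg G
  Ω⇒extremal ω with B′ , packing′ , large ← Ω⇒large-packing G ω =
    ≤-antisym (m+n≤o⇒m≤o∸n ∣ B ∣ bound)
              (m≤n+o⇒m∸n≤o (n + 2) (maxDeg G)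
                (≤-trans large (≤-trans (+-monoˡ-≤ (maxDeg G) (maximum B′ packing′))
                                        (≤-reflexive (+-comm ∣ B ∣ (maxDeg G))))))
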